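{- Let $U$ be a unicyclic graph and let $\tau$ be a 2-switch on $U$ that removes two disjoint edges $e_1,e_2$ of $U$. Then: (1) If $e_1,e_2\in E(\operatorname{For}(U))$, then $\tau(U)$ is unicyclic if and only if, for every $e\in E(\operatorname{Cyc}(U))$, $\tau$ (viewed as a 2-switch on the tree $U-e$) is a t-switch on $U-e$. (2) If $e_1\in E(\operatorname{Cyc}(U))$ and $e_2\in E(\operatorname{For}(U))$, then $\tau(U)$ is unicyclic. (3) If $e_1,e_2\in E(\operatorname{Cyc}(U))$, then $\tau(U)$ is unicyclic if and only if $\tau(\operatorname{Cyc}(U))$ is isomorphic to $\operatorname{Cyc}(U)$.
   Context: Graphs are finite and simple. A unicyclic graph is a connected graph with exactly one cycle. A 2-switch on $G$ is specified by four distinct vertices $a,b,c,d$ with $ab,cd\in E(G)$ and $ac,bd\notin E(G)$; it produces $\tau(G)=G-ab-cd+ac+bd$, and we say it removes $ab$ and $cd$. For a graph $G$, $\operatorname{Cyc}(G)$ is the subgraph of $G$ induced by all vertices lying on some cycle of $G$, and $\operatorname{For}(G)=G-E(\operatorname{Cyc}(G))$. A 2-switch $\tau$ on a tree $T$ is a t-switch if $\tau(T)$ is a tree. -}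

module Defs where

open import Level using (0ℓ)
open import Data.Nat using (ℕ; zero; suc; NonZero)
open import Data.Nat.DivMod using (_%_; m%n<n)
open import Data.Fin using (Fin; toℕ; fromℕ<)
open import Data.Product using (Σ; ∃; _×_; _,_)
open import Data.Sum using (_⊎_)
open import Data.Empty using (⊥)
open import Relation.Nullary using (¬_)
open import Relation.Binary.PropositionalEquality using (_≡_)
open import Function.Bundles using (_↔_; _⇔_; Inverse)

record Graph (n : ℕ) : Set₁ where
  field
    E     : Fin n → Fin n → Set
    sym   : ∀ {x y} → E x y → E y x
    irrefl : ∀ {x} → ¬ E x x
open Graph public

SamePair : ∀ {n} → Fin n → Fin n → Fin n → Fin n → Set
SamePair x y a b = (x ≡ a × y ≡ b) ⊎ (x ≡ b × y ≡ a)

data Walk {n} (G : Graph n) : Fin n → Fin n → Set where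
  here : ∀ {u} → Walk G u u
  step : ∀ {u v w} → E G u v → Walk G v w → Walk G u w

Connected : ∀ {n} → Graph n → Set
Connected {n} G = ∀ (u v : Fin n) → Walk G u v

next : ∀ {k} → Fin (suc k) → Fin (suc k)
next {k} i = fromℕ< (m%n<n (suc (toℕ i)) (suc k))

record Cycle {n} (G : Graph n) : Set where
  field
    len : ℕ
    vtx : Fin (suc (suc (suc len))) → Fin n
    inj : ∀ i j → vtx i ≡ vtx j → i ≡ j
    adj : ∀ i → E G (vtx i) (vtx (next i))
open Cycle public

CycleEdge : ∀ {n} {G : Graph n} → Cycle G → Fin n → Fin n → Set
CycleEdge C x y = ∃ λ i → SamePair x y (vtx C i) (vtx C (next i))

-- two cycles are the same subgraph (same edge set, hence same vertex set)
SameCycle : ∀ {n} {G : Graph n} → Cycle G → Cycle G → Set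
SameCycle {n} C D = ∀ (x y : Fin n) → CycleEdge C x y ⇔ CycleEdge D x y

Unicyclic : ∀ {n} → Graph n → Set
Unicyclic G = Connected G × Σ (Cycle G) (λ C → ∀ (D : Cycle G) → SameCycle C D)

Acyclic : ∀ {n} → Graph n → Set
Acyclic G = ¬ Cycle G

IsTree : ∀ {n} → Graph n → Set
IsTree G = Connected G × Acyclic G

OnCycle : ∀ {n} → Graph n → Fin n → Set
OnCycle G v = Σ (Cycle G) (λ C → ∃ λ i → vtx C i ≡ v)

-- Cyc(G): subgraph induced by the vertices lying on cycles.
-- Represented on the same vertex set Fin n; vertices not on a cycle are
-- left as isolated vertices.
CycE : ∀ {n} → Graph n → Fin n → Fin n → Set
CycE G x y = E G x y × OnCycle G x × OnCycle G y

Cyc : ∀ {n} → Graph n → Graph n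
Cyc G = record
  { E = CycE G
  ; sym = λ { (e , ox , oy) → sym G e , oy , ox }
  ; irrefl = λ { (e , _) → irrefl G e } }

ForE : ∀ {n} → Graph n → Fin n → Fin n → Set
ForE G x y = E G x y × ¬ CycE G x y

deleteEdge : ∀ {n} → Graph n → Fin n → Fin n → Graph n
deleteEdge G a b = record
  { E = λ x y → E G x y × ¬ SamePair x y a b
  ; sym = λ { (e , ne) → sym G e , λ { (Data.Sum.inj₁ (p , q)) → ne (Data.Sum.inj₂ (q , p))
                                     ; (Data.Sum.inj₂ (p , q)) → ne (Data.Sum.inj₁ (q , p)) } }
  ; irrefl = λ { (e , _) → irrefl G e } }

IsTwoSwitch : ∀ {n} → Graph n → Fin n → Fin n → Fin n → Fin n → Set
IsTwoSwitch G a b c d =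
  ¬ a ≡ b × ¬ a ≡ c × ¬ a ≡ d × ¬ b ≡ c × ¬ b ≡ d × ¬ c ≡ d ×
  E G a b × E G c d × ¬ E G a c × ¬ E G b d

SwitchE : ∀ {n} → Graph n → Fin n → Fin n → Fin n → Fin n → Fin n → Fin n → Set
SwitchE G a b c d x y =
  (E G x y × ¬ SamePair x y a b × ¬ SamePair x y c d)
  ⊎ SamePair x y a c ⊎ SamePair x y b d

swapPair : ∀ {n} {x y a b : Fin n} → SamePair x y a b → SamePair y x a b
swapPair (Data.Sum.inj₁ (p , q)) = Data.Sum.inj₂ (q , p)
swapPair (Data.Sum.inj₂ (p , q)) = Data.Sum.inj₁ (q , p)

switch : ∀ {n} (G : Graph n) (a b c d : Fin n) → ¬ a ≡ c → ¬ b ≡ d → Graph n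
switch G a b c d a≢c b≢d = record
  { E = SwitchE G a b c d
  ; sym = λ { (Data.Sum.inj₁ (e , n1 , n2)) → Data.Sum.inj₁ (sym G e , (λ p → n1 (swapPair p)) , (λ p → n2 (swapPair p)))
            ; (Data.Sum.inj₂ (Data.Sum.inj₁ p)) → Data.Sum.inj₂ (Data.Sum.inj₁ (swapPair p))
            ; (Data.Sum.inj₂ (Data.Sum.inj₂ p)) → Data.Sum.inj₂ (Data.Sum.inj₂ (swapPair p)) }
  ; irrefl = irr }
  where
  open import Relation.Binary.PropositionalEquality using (trans) renaming (sym to ≡-sym)
  irr : ∀ {x} → ¬ SwitchE G a b c d x x
  irr (Data.Sum.inj₁ (e , _)) = irrefl G e
  irr (Data.Sum.inj₂ (Data.Sum.inj₁ (Data.Sum.inj₁ (p , q)))) = a≢c (trans (≡-sym p) q)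
  irr (Data.Sum.inj₂ (Data.Sum.inj₁ (Data.Sum.inj₂ (p , q)))) = a≢c (trans (≡-sym q) p)
  irr (Data.Sum.inj₂ (Data.Sum.inj₂ (Data.Sum.inj₁ (p , q)))) = b≢d (trans (≡-sym p) q)
  irr (Data.Sum.inj₂ (Data.Sum.inj₂ (Data.Sum.inj₂ (p , q)))) = b≢d (trans (≡-sym q) p)

IsTSwitch : ∀ {n} (T : Graph n) (a b c d : Fin n) → ¬ a ≡ c → ¬ b ≡ d → Set
IsTSwitch T a b c d a≢c b≢d =
  IsTree T × IsTwoSwitch T a b c d × IsTree (switch T a b c d a≢c b≢d)

Isomorphic : ∀ {n} → Graph n → Graph n → Set
Isomorphic {n} G H = Σ (Fin n ↔ Fin n) λ f →
  ∀ (x y : Fin n) → E G x y ⇔ E H (Inverse.to f x) (Inverse.to f y)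

{-# OPTIONS --safe #-}
-- Let C be the cycle of U, and S = U - ab - cd.
-- (1) If neither ab nor cd lies on C, then C survives in τ(U), and deleting an edge e of C
-- commutes with the switch. A graph with a cycle through e is unicyclic iff deleting e leaves a
-- tree, so τ(U) is unicyclic iff τ(U - e) is a tree for the edges e of C.
-- (2) If ab lies on C and cd does not, U - ab is a tree, so S is a forest of two trees, one
-- containing c and one containing d; a and b lie in the same one, joined by the rest of C. If
-- it is the tree of c, then S + bd is a tree and adding ac to it closes exactly one cycle; if it
-- is the tree of d, the same holds with ac and bd exchanged.
-- (3) If both lie on C, read C from b to a. If it runs b … c d … a, then b and c are joined in S
-- and τ(U) is unicyclic as in (2); its new cycle b … c a … d b is the image of C under reversing
-- the segment b … c. If it runs b … d c … a, then τ splits C into the two cycles b … d b and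
-- c … a c, so neither τ(U) nor τ(Cyc U) has a unique cycle, while Cyc U ⊆ U does.
module Submission where

open import Defs
open import Data.Nat using (ℕ; zero; suc; _+_; _∸_; _<_; _≤_; z≤n; s≤s; _≤?_; _<?_)
open import Data.Nat.Properties
  using (+-comm; +-assoc; +-suc; ≤-refl; <⇒≤; <-trans; <-≤-trans; ≤-<-trans; n<1+n; ≤-pred;
         ≤-antisym; ≮⇒≥; ≰⇒>; ≤∧≢⇒<; <-irrefl; <-cmp; m≤n⇒m<n∨m≡n; m≤m+n; m≤n+m; +-monoˡ-<;
         m∸n+n≡m; m∸n≤m; m∸[m∸n]≡n; n∸n≡0; +-∸-assoc; m≤n⇒∃[o]m+o≡n)
open import Data.Nat.DivMod using (_%_; m%n<n; %-distribˡ-+; m%n%n≡m%n; [m+n]%n≡m%n; m<n⇒m%n≡m; n%n≡0)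
open import Data.Fin using (Fin; toℕ; fromℕ<; fromℕ) renaming (zero to fzero; _≟_ to _≟ᶠ_)
open import Data.Fin.Properties
  using (any?; toℕ<n; toℕ-injective; toℕ-fromℕ<; fromℕ<-toℕ; fromℕ<-cong; toℕ-fromℕ)
open import Data.Product using (Σ; _×_; _,_; proj₁; proj₂)
open import Data.Sum using (_⊎_; inj₁; inj₂; swap)
open import Data.Unit using (⊤; tt)
open import Data.Empty using (⊥-elim)
open import Relation.Nullary using (¬_; Dec; yes; no)
open import Relation.Nullary.Decidable using (_×-dec_; _⊎-dec_)
open import Relation.Binary using (Tri; tri<; tri≈; tri>)
open import Relation.Binary.PropositionalEquality using (_≡_; refl; trans; cong; subst; subst₂) renaming (sym to ≡-sym)
open import Function using (_∘_)
open import Function.Bundles using (_⇔_; mk⇔; Equivalence; _↔_; Inverse; Injection; mk↔ₛ′)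
open import Function.Properties.Inverse using (↔⇒↣)
open import Function.Properties.Equivalence using () renaming (sym to ⇔-sym; trans to ⇔-trans)

module _ {n : ℕ} where

  SamePair-refl : {x y : Fin n} → SamePair x y x y
  SamePair-refl = inj₁ (refl , refl)

  SamePair-sym : {x y a b : Fin n} → SamePair x y a b → SamePair a b x y
  SamePair-sym (inj₁ (refl , refl)) = inj₁ (refl , refl)
  SamePair-sym (inj₂ (refl , refl)) = inj₂ (refl , refl)

  SamePair-swapʳ : {x y a b : Fin n} → SamePair x y a b → SamePair x y b a
  SamePair-swapʳ (inj₁ (p , q)) = inj₂ (p , q)
  SamePair-swapʳ (inj₂ (p , q)) = inj₁ (p , q)

  SamePair-trans : {x y a b c d : Fin n} → SamePair x y a b → SamePair a b c d → SamePair x y c d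
  SamePair-trans (inj₁ (refl , refl)) q = q
  SamePair-trans (inj₂ (refl , refl)) q = swapPair q

  SamePair? : (x y a b : Fin n) → Dec (SamePair x y a b)
  SamePair? x y a b = ((x ≟ᶠ a) ×-dec (y ≟ᶠ b)) ⊎-dec ((x ≟ᶠ b) ×-dec (y ≟ᶠ a))

  SamePair-map : (f : Fin n → Fin n) {x y a b : Fin n} → SamePair x y a b → SamePair (f x) (f y) (f a) (f b)
  SamePair-map f (inj₁ (refl , refl)) = inj₁ (refl , refl)
  SamePair-map f (inj₂ (refl , refl)) = inj₂ (refl , refl)

  SamePair-unmap : (f : Fin n → Fin n) → (∀ {x y} → f x ≡ f y → x ≡ y) →
                   {x y a b : Fin n} → SamePair (f x) (f y) (f a) (f b) → SamePair x y a b
  SamePair-unmap f f-inj (inj₁ (p , q)) = inj₁ (f-inj p , f-inj q)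
  SamePair-unmap f f-inj (inj₂ (p , q)) = inj₂ (f-inj p , f-inj q)

  E-resp-SamePair : (G : Graph n) {x y a b : Fin n} → SamePair x y a b → E G a b → E G x y
  E-resp-SamePair G (inj₁ (refl , refl)) e = e
  E-resp-SamePair G (inj₂ (refl , refl)) e = sym G e

  module _ {G : Graph n} where

    _++ʷ_ : ∀ {u v w} → Walk G u v → Walk G v w → Walk G u w
    here ++ʷ q = q
    step e p ++ʷ q = step e (p ++ʷ q)

    reverseʷ : ∀ {u v} → Walk G u v → Walk G v u
    reverseʷ here = here
    reverseʷ (step e p) = reverseʷ p ++ʷ step (sym G e) here

  record _⊆_ (G H : Graph n) : Set where
    constructor mk⊆
    field ⊆-E : ∀ {x y} → E G x y → E H x y
  open _⊆_ public

  ⊆-trans : {G H K : Graph n} → G ⊆ H → H ⊆ K → G ⊆ K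
  ⊆-trans f g = mk⊆ λ e → ⊆-E g (⊆-E f e)

  _≐_ : Graph n → Graph n → Set
  G ≐ H = G ⊆ H × H ⊆ G

  ≐-sym : {G H : Graph n} → G ≐ H → H ≐ G
  ≐-sym (f , g) = g , f

  ≐-trans : {G H K : Graph n} → G ≐ H → H ≐ K → G ≐ K
  ≐-trans (f , g) (f′ , g′) = ⊆-trans f f′ , ⊆-trans g′ g

  mapʷ : {G H : Graph n} → G ⊆ H → ∀ {u v} → Walk G u v → Walk H u v
  mapʷ f here = here
  mapʷ f (step e p) = step (⊆-E f e) (mapʷ f p)

  bindʷ : {G H : Graph n} → (∀ {x y} → E G x y → Walk H x y) → ∀ {u v} → Walk G u v → Walk H u v
  bindʷ f here = here
  bindʷ f (step e p) = f e ++ʷ bindʷ f p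

  mapCycle : {G H : Graph n} → G ⊆ H → Cycle G → Cycle H
  mapCycle f C = record { len = len C ; vtx = vtx C ; inj = inj C ; adj = λ i → ⊆-E f (adj C i) }

  Acyclic-anti : {G H : Graph n} → G ⊆ H → Acyclic H → Acyclic G
  Acyclic-anti f acyclic C = acyclic (mapCycle f C)

  Connected-mono : {G H : Graph n} → G ⊆ H → Connected G → Connected H
  Connected-mono f connected u v = mapʷ f (connected u v)

  Unicyclic-resp : {G H : Graph n} → G ≐ H → Unicyclic G → Unicyclic H
  Unicyclic-resp (f , g) (connected , C , unique) = Connected-mono f connected , mapCycle f C , λ D → unique (mapCycle g D)

  IsTree-resp : {G H : Graph n} → G ≐ H → IsTree G → IsTree H
  IsTree-resp (f , g) (connected , acyclic) = Connected-mono f connected , Acyclic-anti g acyclic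

  Isomorphic-respˡ : {G H K : Graph n} → G ≐ H → Isomorphic G K → Isomorphic H K
  Isomorphic-respˡ (f , g) (φ , φ-E) =
    φ , λ x y → mk⇔ (λ e → Equivalence.to (φ-E x y) (⊆-E g e)) (λ e → ⊆-E f (Equivalence.from (φ-E x y) e))

  SameCycle-sym : {G : Graph n} {C D : Cycle G} → SameCycle C D → SameCycle D C
  SameCycle-sym same x y = ⇔-sym (same x y)

  SameCycle-trans : {G : Graph n} {C D F : Cycle G} → SameCycle C D → SameCycle D F → SameCycle C F
  SameCycle-trans same same′ x y = ⇔-trans (same x y) (same′ x y)

  addEdge : (G : Graph n) (u v : Fin n) → ¬ u ≡ v → Graph n
  addEdge G u v u≢v = record
    { E = λ x y → E G x y ⊎ SamePair x y u v
    ; sym = λ { (inj₁ e) → inj₁ (sym G e) ; (inj₂ p) → inj₂ (swapPair p) }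
    ; irrefl = λ { (inj₁ e) → irrefl G e
                 ; (inj₂ (inj₁ (refl , refl))) → u≢v refl
                 ; (inj₂ (inj₂ (refl , refl))) → u≢v refl } }

  ⊆-addEdge : (G : Graph n) {u v : Fin n} (u≢v : ¬ u ≡ v) → G ⊆ addEdge G u v u≢v
  ⊆-addEdge G u≢v = mk⊆ inj₁

  addEdge-comm : (G : Graph n) {u v p q : Fin n} (u≢v : ¬ u ≡ v) (p≢q : ¬ p ≡ q) →
                 addEdge (addEdge G u v u≢v) p q p≢q ≐ addEdge (addEdge G p q p≢q) u v u≢v
  addEdge-comm G u≢v p≢q = mk⊆ exchange , mk⊆ exchange
    where
    exchange : ∀ {A B C : Set} → (A ⊎ B) ⊎ C → (A ⊎ C) ⊎ B
    exchange (inj₁ (inj₁ e)) = inj₁ (inj₁ e)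
    exchange (inj₁ (inj₂ p)) = inj₂ p
    exchange (inj₂ p) = inj₁ (inj₂ p)

  deleteEdge-⊆ : (G : Graph n) (a b : Fin n) → deleteEdge G a b ⊆ G
  deleteEdge-⊆ G a b = mk⊆ proj₁

  deleteEdge-resp-SamePair : (G : Graph n) {a b a′ b′ : Fin n} → SamePair a b a′ b′ →
                             deleteEdge G a b ⊆ deleteEdge G a′ b′
  deleteEdge-resp-SamePair G same = mk⊆ λ { (e , ne) → e , λ q → ne (SamePair-trans q (SamePair-sym same)) }

module Modular (l : ℕ) where

  M : ℕ
  M = suc (suc (suc l))

  record _≈_ (a b : ℕ) : Set where
    constructor mk≈
    field ≈⇒%≡ : a % M ≡ b % M
  open _≈_ public

  ≈-sym : ∀ {a b} → a ≈ b → b ≈ a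
  ≈-sym (mk≈ e) = mk≈ (≡-sym e)

  ≈-trans : ∀ {a b c} → a ≈ b → b ≈ c → a ≈ c
  ≈-trans (mk≈ e) (mk≈ f) = mk≈ (trans e f)

  ≡⇒≈ : ∀ {a b} → a ≡ b → a ≈ b
  ≡⇒≈ refl = mk≈ refl

  %-≈ : ∀ a → (a % M) ≈ a
  %-≈ a = mk≈ (m%n%n≡m%n a M)

  M+-≈ : ∀ a → (M + a) ≈ a
  M+-≈ a = mk≈ (trans (cong (_% M) (+-comm M a)) ([m+n]%n≡m%n a M))

  +-congˡ : ∀ {a b} c → a ≈ b → (c + a) ≈ (c + b)
  +-congˡ {a} {b} c (mk≈ e) =
    mk≈ (trans (%-distribˡ-+ c a M) (trans (cong (λ z → (c % M + z) % M) e) (≡-sym (%-distribˡ-+ c b M))))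

  +-congʳ : ∀ {a b} c → a ≈ b → (a + c) ≈ (b + c)
  +-congʳ {a} {b} c e = subst₂ _≈_ (+-comm c a) (+-comm c b) (+-congˡ c e)

  -- Adding M ∸ (c % M) undoes adding c.
  +-cancelʳ : ∀ {a b} c → (a + c) ≈ (b + c) → a ≈ b
  +-cancelʳ {a} {b} c e = ≈-trans (≈-sym (undo a)) (≈-trans (+-congʳ c⁻ e) (undo b))
    where
    c⁻ : ℕ
    c⁻ = M ∸ c % M
    c+c⁻≈M : (c + c⁻) ≈ M
    c+c⁻≈M = ≈-trans (+-congʳ c⁻ (≈-sym (%-≈ c)))
                     (≡⇒≈ (trans (+-comm (c % M) c⁻) (m∸n+n≡m (<⇒≤ (m%n<n c M)))))
    undo : ∀ x → ((x + c) + c⁻) ≈ x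
    undo x = ≈-trans (≡⇒≈ (+-assoc x c c⁻))
             (≈-trans (+-congˡ x c+c⁻≈M) (≈-trans (≡⇒≈ (+-comm x M)) (M+-≈ x)))

  suc-cancel : ∀ {a b} → suc a ≈ suc b → a ≈ b
  suc-cancel {a} {b} e = +-cancelʳ 1 (subst₂ _≈_ (+-comm 1 a) (+-comm 1 b) e)

  +-cancelʳ-< : ∀ {a b} c → a < M → b < M → (a + c) ≈ (b + c) → a ≡ b
  +-cancelʳ-< c a<M b<M e =
    trans (≡-sym (m<n⇒m%n≡m a<M)) (trans (≈⇒%≡ (+-cancelʳ c e)) (m<n⇒m%n≡m b<M))

  2+≉0+ : ∀ c → ¬ (2 + c) ≈ (0 + c)
  2+≉0+ c e with +-cancelʳ-< c (s≤s (s≤s (s≤s z≤n))) (s≤s z≤n) e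
  ... | ()

  offset : ∀ j p → Σ ℕ λ s → s < M × (s + p) ≈ j
  offset j p = s , m%n<n (j + (M ∸ p % M)) M , s+p≈j
    where
    s : ℕ
    s = (j + (M ∸ p % M)) % M
    s+p≈j : (s + p) ≈ j
    s+p≈j = ≈-trans (+-congʳ p (%-≈ (j + (M ∸ p % M))))
            (≈-trans (+-congˡ (j + (M ∸ p % M)) (≈-sym (%-≈ p)))
            (≈-trans (≡⇒≈ (trans (+-assoc j (M ∸ p % M) (p % M)) (cong (j +_) (m∸n+n≡m (<⇒≤ (m%n<n p M))))))
            (≈-trans (≡⇒≈ (+-comm j M)) (M+-≈ j))))

toℕ-next : ∀ {K} (i : Fin (suc K)) → toℕ i < K → toℕ (next i) ≡ suc (toℕ i)
toℕ-next {K} i i<K = trans (toℕ-fromℕ< _) (m<n⇒m%n≡m (s≤s i<K))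

next-last : ∀ {K} (i : Fin (suc K)) → toℕ i ≡ K → next i ≡ fzero
next-last {K} i i≡K = toℕ-injective (trans (toℕ-fromℕ< _) (trans (cong (λ k → suc k % suc K) i≡K) (n%n≡0 (suc K))))

<⊎last : ∀ {K} (i : Fin (suc K)) → toℕ i < K ⊎ toℕ i ≡ K
<⊎last {K} i with toℕ i <? K
... | yes i<K = inj₁ i<K
... | no i≮K = inj₂ (≤-antisym (≤-pred (toℕ<n i)) (≮⇒≥ i≮K))

-- Cycle vertices are indexed by all of ℕ, cyclically modulo the length M; the index map is kept
-- abstract so that only its stated equations are ever unfolded. Indexing depends on the vertex
-- list only, so a cycle and its image in a larger graph share their indexing.
module Indexing {n : ℕ} (l : ℕ) (vt : Fin (suc (suc (suc l))) → Fin n)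
                (vt-inj : ∀ i j → vt i ≡ vt j → i ≡ j) where
  open Modular l public

  abstract
    position : ℕ → Fin M
    position k = fromℕ< (m%n<n k M)

    vertex : ℕ → Fin n
    vertex k = vt (position k)

    vertex-cong : ∀ {j k} → j ≈ k → vertex j ≡ vertex k
    vertex-cong e = cong vt (fromℕ<-cong _ _ (≈⇒%≡ e) _ _)

    vertex-injective : ∀ {j k} → vertex j ≡ vertex k → j ≈ k
    vertex-injective {j} {k} e =
      mk≈ (trans (≡-sym (toℕ-fromℕ< (m%n<n j M))) (trans (cong toℕ (vt-inj _ _ e)) (toℕ-fromℕ< (m%n<n k M))))

    vtx-position : ∀ k → vt (position k) ≡ vertex k
    vtx-position k = refl

    vtx-next-position : ∀ k → vt (next (position k)) ≡ vertex (suc k)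
    vtx-next-position k =
      cong vt (fromℕ<-cong _ _ (≈⇒%≡ (+-congˡ 1 (≈-trans (≡⇒≈ (toℕ-fromℕ< (m%n<n k M))) (%-≈ k)))) _ _)

    vtx≡vertex : ∀ i → vt i ≡ vertex (toℕ i)
    vtx≡vertex i =
      cong vt (≡-sym (trans (fromℕ<-cong _ _ (m<n⇒m%n≡m (toℕ<n i)) _ (toℕ<n i)) (fromℕ<-toℕ i (toℕ<n i))))

    vtx-next≡vertex : ∀ i → vt (next i) ≡ vertex (suc (toℕ i))
    vtx-next≡vertex i = refl

module CycleIndex {n : ℕ} {G : Graph n} (C : Cycle G) where
  open Indexing (len C) (vtx C) (inj C) public

  vertex-adj : ∀ k → E G (vertex k) (vertex (suc k))
  vertex-adj k = subst₂ (E G) (vtx-position k) (vtx-next-position k) (adj C (position k))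

  EdgeAt : ℕ → Fin n → Fin n → Set
  EdgeAt k x y = SamePair x y (vertex k) (vertex (suc k))

  CycleEdge⇒EdgeAt : ∀ {x y} → CycleEdge C x y → Σ ℕ λ k → EdgeAt k x y
  CycleEdge⇒EdgeAt (i , xy) = toℕ i , subst₂ (SamePair _ _) (vtx≡vertex i) (vtx-next≡vertex i) xy

  EdgeAt⇒CycleEdge : ∀ {k x y} → EdgeAt k x y → CycleEdge C x y
  EdgeAt⇒CycleEdge {k} xy =
    position k , subst₂ (SamePair _ _) (≡-sym (vtx-position k)) (≡-sym (vtx-next-position k)) xy

  EdgeAt-injective : ∀ {j k} → EdgeAt j (vertex k) (vertex (suc k)) → k ≈ j
  EdgeAt-injective (inj₁ (p , _)) = vertex-injective p
  EdgeAt-injective {j} {k} (inj₂ (p , q)) =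
    ⊥-elim (2+≉0+ j (≈-trans (≈-sym (+-congˡ 1 (vertex-injective {k} {suc j} p))) (vertex-injective q)))

  forwardWalk : (H : Graph n) (p s : ℕ) → (∀ t → t < s → E H (vertex (t + p)) (vertex (suc (t + p)))) →
                Walk H (vertex p) (vertex (s + p))
  forwardWalk H p zero h = here
  forwardWalk H p (suc s) h =
    step (h 0 (s≤s z≤n))
         (subst (λ z → Walk H (vertex (suc p)) (vertex z)) (+-suc s p)
                (forwardWalk H (suc p) s λ t t<s →
                  subst (λ z → E H (vertex z) (vertex (suc z))) (≡-sym (+-suc t p)) (h (suc t) (s≤s t<s))))

  private
    walkAround-avoids : ∀ k t → t < suc (suc (len C)) → ¬ EdgeAt k (vertex (t + suc k)) (vertex (suc (t + suc k)))
    walkAround-avoids k t t<M-1 xy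
      with +-cancelʳ-< k (s≤s t<M-1) (s≤s z≤n) (≈-trans (≡⇒≈ (≡-sym (+-suc t k))) (EdgeAt-injective xy))
    ... | ()

  walkAround : (H : Graph n) (k : ℕ) →
               (∀ j → ¬ EdgeAt k (vertex j) (vertex (suc j)) → E H (vertex j) (vertex (suc j))) →
               Walk H (vertex (suc k)) (vertex k)
  walkAround H k h =
    subst (Walk H (vertex (suc k))) (vertex-cong (≈-trans (≡⇒≈ (+-suc (suc (suc (len C))) k)) (M+-≈ k)))
          (forwardWalk H (suc k) (suc (suc (len C))) λ t t<M-1 → h (t + suc k) (walkAround-avoids k t t<M-1))

  walkAround-deleteEdge : ∀ k → Walk (deleteEdge G (vertex k) (vertex (suc k))) (vertex (suc k)) (vertex k)
  walkAround-deleteEdge k = walkAround _ k λ j j≠k → vertex-adj j , j≠k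

  module _ (H : Graph n) (p l′ : ℕ) (arc-adj : ∀ t → t < suc (suc l′) → E H (vertex (t + p)) (vertex (suc (t + p))))
           (closing : E H (vertex (suc (suc l′) + p)) (vertex p)) (l′+2<M : suc (suc l′) < M) where

    arc : Cycle H
    arc = record { len = l′ ; vtx = λ i → vertex (toℕ i + p) ; inj = arc-inj ; adj = adjacent }
      where
      arc-inj : ∀ i j → vertex (toℕ i + p) ≡ vertex (toℕ j + p) → i ≡ j
      arc-inj i j e =
        toℕ-injective (+-cancelʳ-< p (<-≤-trans (toℕ<n i) l′+2<M) (<-≤-trans (toℕ<n j) l′+2<M) (vertex-injective e))
      adjacent : ∀ i → E H (vertex (toℕ i + p)) (vertex (toℕ (next i) + p))
      adjacent i with <⊎last i
      ... | inj₁ i<last rewrite toℕ-next i i<last = arc-adj (toℕ i) i<last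
      ... | inj₂ i≡last rewrite next-last i i≡last | i≡last = closing

    arc-closingEdge : CycleEdge arc (vertex (suc (suc l′) + p)) (vertex p)
    arc-closingEdge =
      fromℕ (suc (suc l′)) ,
      inj₁ (cong (λ z → vertex (z + p)) (≡-sym (toℕ-fromℕ (suc (suc l′)))) ,
            cong (λ z → vertex (toℕ z + p)) (≡-sym (next-last (fromℕ (suc (suc l′))) (toℕ-fromℕ _))))

    arc-edges : ∀ {x y} → CycleEdge arc x y →
                (Σ ℕ λ t → t < suc (suc l′) × EdgeAt (t + p) x y) ⊎
                SamePair x y (vertex (suc (suc l′) + p)) (vertex p)
    arc-edges (i , xy) with <⊎last i
    ... | inj₁ i<last rewrite toℕ-next i i<last = inj₁ (toℕ i , i<last , xy)
    ... | inj₂ i≡last rewrite next-last i i≡last | i≡last = inj₂ xy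

module _ {n : ℕ} {G : Graph n} where

  walkLength : ∀ {u v} → Walk G u v → ℕ
  walkLength here = 0
  walkLength (step e w) = suc (walkLength w)

  vertexAt : ∀ {u v} → Walk G u v → ℕ → Fin n
  vertexAt {u} here k = u
  vertexAt {u} (step e w) zero = u
  vertexAt (step e w) (suc k) = vertexAt w k

  _∉ʷ_ : ∀ {u v} → Fin n → Walk G u v → Set
  x ∉ʷ here {u} = ¬ x ≡ u
  x ∉ʷ step {u} e w = ¬ x ≡ u × x ∉ʷ w

  IsPath : ∀ {u v} → Walk G u v → Set
  IsPath here = ⊤
  IsPath (step {u} e w) = u ∉ʷ w × IsPath w

  suffixFrom : ∀ {u v} (x : Fin n) (w : Walk G u v) → x ∉ʷ w ⊎ Σ (Walk G x v) (λ q → IsPath w → IsPath q)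
  suffixFrom x (here {u}) with x ≟ᶠ u
  ... | yes refl = inj₂ (here , λ _ → tt)
  ... | no x≢u = inj₁ x≢u
  suffixFrom x (step {u} e w) with x ≟ᶠ u
  ... | yes refl = inj₂ (step e w , λ path → path)
  ... | no x≢u with suffixFrom x w
  ...   | inj₁ x∉w = inj₁ (x≢u , x∉w)
  ...   | inj₂ (q , q-path) = inj₂ (q , λ path → q-path (proj₂ path))

  toPath : ∀ {u v} → Walk G u v → Σ (Walk G u v) IsPath
  toPath here = here , tt
  toPath (step {u} e w) with toPath w
  ... | p , p-path with suffixFrom u p
  ...   | inj₁ u∉p = step e p , u∉p , p-path
  ...   | inj₂ (q , q-path) = q , q-path p-path

  vertexAt-0 : ∀ {u v} (w : Walk G u v) → vertexAt w 0 ≡ u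
  vertexAt-0 here = refl
  vertexAt-0 (step e w) = refl

  vertexAt-length : ∀ {u v} (w : Walk G u v) → vertexAt w (walkLength w) ≡ v
  vertexAt-length here = refl
  vertexAt-length (step e w) = vertexAt-length w

  vertexAt-adj : ∀ {u v} (w : Walk G u v) k → k < walkLength w → E G (vertexAt w k) (vertexAt w (suc k))
  vertexAt-adj (step e w) zero _ = subst (E G _) (≡-sym (vertexAt-0 w)) e
  vertexAt-adj (step e w) (suc k) (s≤s k<len) = vertexAt-adj w k k<len

  vertexAt-∉ʷ : ∀ {u v x} (w : Walk G u v) → x ∉ʷ w → ∀ k → k ≤ walkLength w → ¬ vertexAt w k ≡ x
  vertexAt-∉ʷ here x∉w k _ eq = x∉w (≡-sym eq)
  vertexAt-∉ʷ (step e w) (x≢u , _) zero _ eq = x≢u (≡-sym eq)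
  vertexAt-∉ʷ (step e w) (_ , x∉w) (suc k) (s≤s k≤len) eq = vertexAt-∉ʷ w x∉w k k≤len eq

  vertexAt-injective : ∀ {u v} (w : Walk G u v) → IsPath w →
                       ∀ j k → j ≤ walkLength w → k ≤ walkLength w → vertexAt w j ≡ vertexAt w k → j ≡ k
  vertexAt-injective here _ zero zero _ _ _ = refl
  vertexAt-injective (step e w) _ zero zero _ _ _ = refl
  vertexAt-injective (step e w) (u∉w , _) zero (suc k) _ (s≤s k≤len) eq =
    ⊥-elim (vertexAt-∉ʷ w u∉w k k≤len (≡-sym eq))
  vertexAt-injective (step e w) (u∉w , _) (suc j) zero (s≤s j≤len) _ eq = ⊥-elim (vertexAt-∉ʷ w u∉w j j≤len eq)
  vertexAt-injective (step e w) (_ , path) (suc j) (suc k) (s≤s j≤len) (s≤s k≤len) eq =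
    cong suc (vertexAt-injective w path j k j≤len k≤len eq)

  closePath : ∀ {x y} (w : Walk G y x) → IsPath w → (l : ℕ) → walkLength w ≡ suc (suc l) → E G x y → Cycle G
  closePath w path l len≡ closing = record { len = l ; vtx = λ i → vertexAt w (toℕ i) ; inj = path-inj ; adj = adjacent }
    where
    bound : ∀ (i : Fin (suc (suc (suc l)))) → toℕ i ≤ walkLength w
    bound i = subst (toℕ i ≤_) (≡-sym len≡) (≤-pred (toℕ<n i))
    path-inj : ∀ i j → vertexAt w (toℕ i) ≡ vertexAt w (toℕ j) → i ≡ j
    path-inj i j e = toℕ-injective (vertexAt-injective w path _ _ (bound i) (bound j) e)
    adjacent : ∀ i → E G (vertexAt w (toℕ i)) (vertexAt w (toℕ (next i)))
    adjacent i with <⊎last i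
    ... | inj₁ i<last rewrite toℕ-next i i<last = vertexAt-adj w (toℕ i) (subst (toℕ i <_) (≡-sym len≡) i<last)
    ... | inj₂ i≡last rewrite next-last i i≡last | i≡last =
      subst₂ (E G) (trans (≡-sym (vertexAt-length w)) (cong (vertexAt w) len≡)) (≡-sym (vertexAt-0 w)) closing

module _ {n : ℕ} {G H : Graph n} (f : G ⊆ H) where

  walkLength-mapʷ : ∀ {u v} (w : Walk G u v) → walkLength (mapʷ f w) ≡ walkLength w
  walkLength-mapʷ here = refl
  walkLength-mapʷ (step e w) = cong suc (walkLength-mapʷ w)

  mapʷ-∉ʷ : ∀ {u v x} (w : Walk G u v) → x ∉ʷ w → x ∉ʷ mapʷ f w
  mapʷ-∉ʷ here x∉w = x∉w
  mapʷ-∉ʷ (step e w) (x≢u , x∉w) = x≢u , mapʷ-∉ʷ w x∉w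

  mapʷ-IsPath : ∀ {u v} (w : Walk G u v) → IsPath w → IsPath (mapʷ f w)
  mapʷ-IsPath here _ = tt
  mapʷ-IsPath (step e w) (u∉w , path) = mapʷ-∉ʷ w u∉w , mapʷ-IsPath w path

-- The hypotheses u ≢ v and vu ∉ H ensure that the path extracted from the walk has at least two edges.
closeWalk : ∀ {n} {G H : Graph n} {u v : Fin n} → H ⊆ G → E G u v → ¬ u ≡ v → ¬ E H v u → Walk H v u → Cycle G
closeWalk {H = H} {u} {v} H⊆G uv u≢v vu∉H w = closeSubpath (proj₁ (toPath w)) (proj₂ (toPath w))
  where
  closeSubpath : (w : Walk H v u) → IsPath w → Cycle _
  closeSubpath here _ = ⊥-elim (u≢v refl)
  closeSubpath (step e here) _ = ⊥-elim (vu∉H e)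
  closeSubpath w@(step _ (step _ w′)) path =
    closePath (mapʷ H⊆G w) (mapʷ-IsPath H⊆G w path) (walkLength w′) (walkLength-mapʷ H⊆G w) uv

edge+detour⇒Cycle : ∀ {n} (G : Graph n) {x y : Fin n} → E G x y → Walk (deleteEdge G x y) y x → Cycle G
edge+detour⇒Cycle G {x} {y} xy =
  closeWalk (deleteEdge-⊆ G x y) xy (λ { refl → irrefl G xy }) (λ (_ , yx≢xy) → yx≢xy (inj₂ (refl , refl)))

Walk-resp-SamePair : ∀ {n} {G : Graph n} {u v x y : Fin n} → SamePair u v x y → Walk G x y → Walk G u v
Walk-resp-SamePair (inj₁ (refl , refl)) w = w
Walk-resp-SamePair (inj₂ (refl , refl)) w = reverseʷ w

-- A cycle through the new edge uv is, apart from uv, a walk from v to u in G.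
addEdge-acyclic : ∀ {n} (G : Graph n) (u v : Fin n) (u≢v : ¬ u ≡ v) → Acyclic G → ¬ Walk G u v →
                  Acyclic (addEdge G u v u≢v)
addEdge-acyclic G u v u≢v acyclic no-walk D with any? (λ i → SamePair? (vtx D i) (vtx D (next i)) u v)
... | no uv∉D = acyclic (record { len = len D ; vtx = vtx D ; inj = inj D ; adj = adjacent })
  where
  adjacent : ∀ i → E G (vtx D i) (vtx D (next i))
  adjacent i with adj D i
  ... | inj₁ e = e
  ... | inj₂ uv = ⊥-elim (uv∉D (i , uv))
... | yes (i , uv) = no-walk (Walk-resp-SamePair uv-at-k (reverseʷ (walkAround G k other-edges)))
  where
  open CycleIndex D
  k : ℕ
  k = toℕ i
  uv-at-k : EdgeAt k u v
  uv-at-k = SamePair-sym (subst₂ (λ x y → SamePair x y u v) (vtx≡vertex i) (vtx-next≡vertex i) uv)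
  other-edges : ∀ j → ¬ EdgeAt k (vertex j) (vertex (suc j)) → E G (vertex j) (vertex (suc j))
  other-edges j j≠k with vertex-adj j
  ... | inj₁ e = e
  ... | inj₂ uv′ = ⊥-elim (j≠k (SamePair-trans uv′ uv-at-k))

module _ {n : ℕ} {G : Graph n} (C : Cycle G) where
  private module C = CycleIndex C

  module _ (deletion-acyclic : ∀ k → Acyclic (deleteEdge G (C.vertex k) (C.vertex (suc k)))) (D : Cycle G) where
    private module D = CycleIndex D

    private
      -- Deleting an edge of C leaves no cycle, so every cycle passes through it.
      C⊆D : ∀ k → Σ ℕ λ j → D.EdgeAt j (C.vertex k) (C.vertex (suc k))
      C⊆D k with any? (λ j → SamePair? (C.vertex k) (C.vertex (suc k)) (vtx D j) (vtx D (next j)))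
      ... | yes (j , e) = toℕ j , subst₂ (SamePair _ _) (D.vtx≡vertex j) (D.vtx-next≡vertex j) e
      ... | no e∉D = ⊥-elim (deletion-acyclic k (record
              { len = len D ; vtx = vtx D ; inj = inj D ; adj = λ i → adj D i , λ e → e∉D (i , SamePair-sym e) }))

      InC : ℕ → Set
      InC j = Σ ℕ λ k → C.EdgeAt k (D.vertex j) (D.vertex (suc j))

      -- If edge j of D is edge k of C, the C-edge leaving the shared endpoint D.vertex (suc j)
      -- lies on D as well, and it cannot be edge j again; so it is edge suc j of D.
      InC-suc : ∀ j → InC j → InC (suc j)
      InC-suc j (k , inj₁ (j≡k , sj≡sk)) with C⊆D (suc k)
      ... | l , inj₁ (sk≡l , ssk≡sl) =
        suc k , inj₁ (sj≡sk , trans (D.vertex-cong (D.+-congˡ 1 sj≈l)) (≡-sym ssk≡sl))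
        where
        sj≈l : suc j D.≈ l
        sj≈l = D.vertex-injective (trans sj≡sk sk≡l)
      ... | l , inj₂ (sk≡sl , ssk≡l) = ⊥-elim (C.2+≉0+ k (C.≈-sym (C.vertex-injective k≡ssk)))
        where
        k≡ssk : C.vertex k ≡ C.vertex (suc (suc k))
        k≡ssk = trans (≡-sym j≡k)
                (trans (D.vertex-cong (D.suc-cancel (D.vertex-injective (trans sj≡sk sk≡sl)))) (≡-sym ssk≡l))
      InC-suc j (k , inj₂ (j≡sk , sj≡k)) with C⊆D (suc (suc (len C)) + k)
      ... | l , inj₁ (k′≡l , sk′≡sl) = ⊥-elim (M-1≢1 (C.+-cancelʳ-< k ≤-refl (s≤s (s≤s z≤n)) k′≈1+k))
        where
        sk′≡k : C.vertex (suc (suc (suc (len C)) + k)) ≡ C.vertex k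
        sk′≡k = C.vertex-cong (C.M+-≈ k)
        l≈j : l D.≈ j
        l≈j = D.suc-cancel (D.vertex-injective (trans (≡-sym sk′≡sl) (trans sk′≡k (≡-sym sj≡k))))
        k′≈1+k : (suc (suc (len C)) + k) C.≈ (1 + k)
        k′≈1+k = C.vertex-injective (trans k′≡l (trans (D.vertex-cong l≈j) j≡sk))
        M-1≢1 : ¬ suc (suc (len C)) ≡ 1
        M-1≢1 ()
      ... | l , inj₂ (k′≡sl , sk′≡l) = suc (suc (len C)) + k , inj₂ (sj≡sk′ , ssj≡k′)
        where
        sk′≡k : C.vertex (suc (suc (suc (len C)) + k)) ≡ C.vertex k
        sk′≡k = C.vertex-cong (C.M+-≈ k)
        l≈sj : l D.≈ suc j
        l≈sj = D.vertex-injective (trans (≡-sym sk′≡l) (trans sk′≡k (≡-sym sj≡k)))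
        sj≡sk′ : D.vertex (suc j) ≡ C.vertex (suc (suc (suc (len C)) + k))
        sj≡sk′ = trans (D.vertex-cong (D.≈-sym l≈sj)) (≡-sym sk′≡l)
        ssj≡k′ : D.vertex (suc (suc j)) ≡ C.vertex (suc (suc (len C)) + k)
        ssj≡k′ = trans (D.vertex-cong (D.+-congˡ 1 (D.≈-sym l≈sj))) (≡-sym k′≡sl)

      InC-+ : ∀ j → InC j → ∀ t → InC (t + j)
      InC-+ j in-C zero = in-C
      InC-+ j in-C (suc t) = InC-suc (t + j) (InC-+ j in-C t)

      D⊆C : ∀ j → InC j
      D⊆C j with C⊆D 0
      ... | j₀ , e₀ with D.offset j j₀
      ...   | s , _ , s+j₀≈j with InC-+ j₀ (0 , SamePair-sym e₀) s
      ...     | k , e =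
        k , subst₂ (λ x y → SamePair x y _ _) (D.vertex-cong s+j₀≈j) (D.vertex-cong (D.+-congˡ 1 s+j₀≈j)) e

    unique-if-deletions-acyclic : SameCycle C D
    unique-if-deletions-acyclic x y = mk⇔ (C⇒D ∘ C.CycleEdge⇒EdgeAt) (D⇒C ∘ D.CycleEdge⇒EdgeAt)
      where
      C⇒D : (Σ ℕ λ k → C.EdgeAt k x y) → CycleEdge D x y
      C⇒D (k , xy) = D.EdgeAt⇒CycleEdge (SamePair-trans xy (proj₂ (C⊆D k)))
      D⇒C : (Σ ℕ λ j → D.EdgeAt j x y) → CycleEdge C x y
      D⇒C (j , xy) = C.EdgeAt⇒CycleEdge (SamePair-trans xy (proj₂ (D⊆C j)))

module UniqueCycle {n : ℕ} {G : Graph n} (C : Cycle G) (unique : ∀ D → SameCycle C D) where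
  open CycleIndex C

  deleteCycleEdge-acyclic : ∀ k → Acyclic (deleteEdge G (vertex k) (vertex (suc k)))
  deleteCycleEdge-acyclic k D
    with Equivalence.to (unique (mapCycle (deleteEdge-⊆ G _ _) D) (vertex k) (vertex (suc k)))
                        (EdgeAt⇒CycleEdge SamePair-refl)
  ... | i , e = proj₂ (adj D i) (SamePair-sym e)

  deleteCycleEdge-connected : Connected G → ∀ k → Connected (deleteEdge G (vertex k) (vertex (suc k)))
  deleteCycleEdge-connected connected k u v = bindʷ detour (connected u v)
    where
    detour : ∀ {x y} → E G x y → Walk (deleteEdge G (vertex k) (vertex (suc k))) x y
    detour {x} {y} e with SamePair? x y (vertex k) (vertex (suc k))
    ... | no xy≠k = step (e , xy≠k) here
    ... | yes xy=k = Walk-resp-SamePair xy=k (reverseʷ (walkAround-deleteEdge k))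

  deleteCycleEdge-isTree : Connected G → ∀ k {x y} → EdgeAt k x y → IsTree (deleteEdge G x y)
  deleteCycleEdge-isTree connected k xy =
    IsTree-resp (deleteEdge-resp-SamePair G (SamePair-sym xy) , deleteEdge-resp-SamePair G xy)
                (deleteCycleEdge-connected connected k , deleteCycleEdge-acyclic k)

-- The new edge closes the tree path from v to u into a cycle C. Deleting uv from T + uv gives T back;
-- deleting any other edge xy of C leaves u and v apart in T - xy (a walk would close a cycle of T
-- through xy), so (T - xy) + uv is acyclic too.
tree+edge-unicyclic : ∀ {n} (T : Graph n) (u v : Fin n) (u≢v : ¬ u ≡ v) → IsTree T → ¬ E T u v →
                      Unicyclic (addEdge T u v u≢v)
tree+edge-unicyclic T u v u≢v (connected , acyclic) uv∉T =
  Connected-mono (⊆-addEdge T u≢v) connected , C , unique-if-deletions-acyclic C deletion-acyclic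
  where
  G : Graph _
  G = addEdge T u v u≢v
  C : Cycle G
  C = closeWalk (⊆-addEdge T u≢v) (inj₂ SamePair-refl) u≢v (λ vu → uv∉T (sym T vu)) (connected v u)
  open CycleIndex C
  deletion-acyclic : ∀ k → Acyclic (deleteEdge G (vertex k) (vertex (suc k)))
  deletion-acyclic k with SamePair? (vertex k) (vertex (suc k)) u v | vertex-adj k
  ... | yes k=uv | _ =
    Acyclic-anti (mk⊆ λ { (inj₁ e , _) → e ; (inj₂ uv , ≠k) → ⊥-elim (≠k (SamePair-trans uv (SamePair-sym k=uv))) }) acyclic
  ... | no k≠uv | inj₂ k=uv = ⊥-elim (k≠uv k=uv)
  ... | no k≠uv | inj₁ xy∈T =
    Acyclic-anti (mk⊆ λ { (inj₁ e , ≠k) → inj₁ (e , ≠k) ; (inj₂ uv , _) → inj₂ uv })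
                 (addEdge-acyclic (deleteEdge T x y) u v u≢v (Acyclic-anti (deleteEdge-⊆ T x y) acyclic) apart)
    where
    x y : Fin _
    x = vertex k
    y = vertex (suc k)
    apart : ¬ Walk (deleteEdge T x y) u v
    apart w = acyclic (edge+detour⇒Cycle T xy∈T (bindʷ inT (walkAround-deleteEdge k)))
      where
      inT : ∀ {p q} → E (deleteEdge G x y) p q → Walk (deleteEdge T x y) p q
      inT (inj₁ e , ≠k) = step (e , ≠k) here
      inT (inj₂ pq=uv , _) = Walk-resp-SamePair pq=uv w

deleteEdge-reachesEndpoint : ∀ {n} (G : Graph n) (c d : Fin n) {z : Fin n} → Walk G z c →
                             Walk (deleteEdge G c d) z c ⊎ Walk (deleteEdge G c d) z d
deleteEdge-reachesEndpoint G c d here = inj₁ here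
deleteEdge-reachesEndpoint G c d (step {u} {v} e w) with SamePair? u v c d | deleteEdge-reachesEndpoint G c d w
... | yes (inj₁ (refl , _)) | _ = inj₁ here
... | yes (inj₂ (refl , _)) | _ = inj₂ here
... | no uv≠cd | inj₁ w′ = inj₁ (step (e , uv≠cd) w′)
... | no uv≠cd | inj₂ w′ = inj₂ (step (e , uv≠cd) w′)

record TwoTrees {n : ℕ} (S : Graph n) (c d : Fin n) : Set where
  field
    acyclic : Acyclic S
    apart : ¬ Walk S c d
    reach : ∀ z → Walk S z c ⊎ Walk S z d

deleteEdge-TwoTrees : ∀ {n} {T : Graph n} {c d : Fin n} → IsTree T → E T c d → TwoTrees (deleteEdge T c d) c d
deleteEdge-TwoTrees {T = T} {c} {d} (connected , acyclic) cd = record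
  { acyclic = Acyclic-anti (deleteEdge-⊆ T c d) acyclic
  ; apart = λ w → acyclic (edge+detour⇒Cycle T cd (reverseʷ w))
  ; reach = λ z → deleteEdge-reachesEndpoint T c d (connected z c) }

TwoTrees-swap : ∀ {n} {S : Graph n} {c d : Fin n} → TwoTrees S c d → TwoTrees S d c
TwoTrees-swap two = record { acyclic = acyclic ; apart = λ w → apart (reverseʷ w) ; reach = λ z → swap (reach z) }
  where open TwoTrees two

TwoTrees-join : ∀ {n} {S : Graph n} {c d x y : Fin n} (x≢y : ¬ x ≡ y) → TwoTrees S c d →
                Walk S x c → Walk S y d → IsTree (addEdge S x y x≢y)
TwoTrees-join {S = S} {c} {d} {x} {y} x≢y two xc yd =
  connected , addEdge-acyclic S x y x≢y acyclic (λ w → apart (reverseʷ xc ++ʷ (w ++ʷ yd)))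
  where
  open TwoTrees two
  toc : ∀ z → Walk (addEdge S x y x≢y) z c
  toc z with reach z
  ... | inj₁ zc = mapʷ (⊆-addEdge S x≢y) zc
  ... | inj₂ zd =
    mapʷ (⊆-addEdge S x≢y) (zd ++ʷ reverseʷ yd) ++ʷ step (inj₂ (inj₂ (refl , refl))) (mapʷ (⊆-addEdge S x≢y) xc)
  connected : Connected (addEdge S x y x≢y)
  connected u v = toc u ++ʷ reverseʷ (toc v)

record TwoSwitch {n : ℕ} (G : Graph n) (a b c d : Fin n) : Set where
  field
    a≢b : ¬ a ≡ b
    a≢d : ¬ a ≡ d
    b≢c : ¬ b ≡ c
    c≢d : ¬ c ≡ d
    ab∈G : E G a b
    cd∈G : E G c d
    ac∉G : ¬ E G a c
    bd∉G : ¬ E G b d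

twoSwitch : ∀ {n} {G : Graph n} {a b c d : Fin n} → IsTwoSwitch G a b c d → TwoSwitch G a b c d
twoSwitch (a≢b , _ , a≢d , b≢c , _ , c≢d , ab , cd , ac∉ , bd∉) = record
  { a≢b = a≢b ; a≢d = a≢d ; b≢c = b≢c ; c≢d = c≢d ; ab∈G = ab ; cd∈G = cd ; ac∉G = ac∉ ; bd∉G = bd∉ }

TwoSwitch-flip : ∀ {n} {G : Graph n} {a b c d : Fin n} → ¬ a ≡ c → ¬ b ≡ d →
                 TwoSwitch G a b c d → TwoSwitch G b a d c
TwoSwitch-flip {G = G} a≢c b≢d sw = record
  { a≢b = λ e → a≢b (≡-sym e) ; a≢d = b≢c ; b≢c = a≢d ; c≢d = λ e → c≢d (≡-sym e)
  ; ab∈G = sym G ab∈G ; cd∈G = sym G cd∈G ; ac∉G = bd∉G ; bd∉G = ac∉G }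
  where open TwoSwitch sw

IsTwoSwitch-deleteEdge : ∀ {n} {G : Graph n} {a b c d x y : Fin n} → ¬ a ≡ c → ¬ b ≡ d → TwoSwitch G a b c d →
                         ¬ SamePair a b x y → ¬ SamePair c d x y → IsTwoSwitch (deleteEdge G x y) a b c d
IsTwoSwitch-deleteEdge a≢c b≢d sw ab≠xy cd≠xy =
  a≢b , a≢c , a≢d , b≢c , b≢d , c≢d , (ab∈G , ab≠xy) , (cd∈G , cd≠xy) ,
  (λ e → ac∉G (proj₁ e)) , (λ e → bd∉G (proj₁ e))
  where open TwoSwitch sw

module _ {n : ℕ} (G : Graph n) (a b c d : Fin n) (a≢c : ¬ a ≡ c) (b≢d : ¬ b ≡ d) where

  switch-≐-addEdge² : switch G a b c d a≢c b≢d ≐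
                      addEdge (addEdge (deleteEdge (deleteEdge G a b) c d) a c a≢c) b d b≢d
  switch-≐-addEdge² = mk⊆ to , mk⊆ from
    where
    to : ∀ {x y} → SwitchE G a b c d x y →
         E (addEdge (addEdge (deleteEdge (deleteEdge G a b) c d) a c a≢c) b d b≢d) x y
    to (inj₁ (e , ≠ab , ≠cd)) = inj₁ (inj₁ ((e , ≠ab) , ≠cd))
    to (inj₂ (inj₁ ac)) = inj₁ (inj₂ ac)
    to (inj₂ (inj₂ bd)) = inj₂ bd
    from : ∀ {x y} → E (addEdge (addEdge (deleteEdge (deleteEdge G a b) c d) a c a≢c) b d b≢d) x y →
           SwitchE G a b c d x y
    from (inj₁ (inj₁ ((e , ≠ab) , ≠cd))) = inj₁ (e , ≠ab , ≠cd)
    from (inj₁ (inj₂ ac)) = inj₂ (inj₁ ac)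
    from (inj₂ bd) = inj₂ (inj₂ bd)

  switch-flip-⊆ : switch G a b c d a≢c b≢d ⊆ switch G b a d c b≢d a≢c
  switch-flip-⊆ = mk⊆ λ
    { (inj₁ (e , ≠ab , ≠cd)) → inj₁ (e , (λ q → ≠ab (SamePair-swapʳ q)) , (λ q → ≠cd (SamePair-swapʳ q)))
    ; (inj₂ (inj₁ ac)) → inj₂ (inj₂ ac)
    ; (inj₂ (inj₂ bd)) → inj₂ (inj₁ bd) }

  switch-deleteEdge-comm : ∀ {x y} → E G x y → ¬ E G a c → ¬ E G b d →
                           deleteEdge (switch G a b c d a≢c b≢d) x y ≐ switch (deleteEdge G x y) a b c d a≢c b≢d
  switch-deleteEdge-comm {x} {y} xy ac∉G bd∉G = mk⊆ to , mk⊆ from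
    where
    to : ∀ {u v} → E (deleteEdge (switch G a b c d a≢c b≢d) x y) u v →
         E (switch (deleteEdge G x y) a b c d a≢c b≢d) u v
    to (inj₁ (e , ≠ab , ≠cd) , ≠xy) = inj₁ ((e , ≠xy) , ≠ab , ≠cd)
    to (inj₂ new , _) = inj₂ new
    from : ∀ {u v} → E (switch (deleteEdge G x y) a b c d a≢c b≢d) u v →
           E (deleteEdge (switch G a b c d a≢c b≢d) x y) u v
    from (inj₁ ((e , ≠xy) , ≠ab , ≠cd)) = inj₁ (e , ≠ab , ≠cd) , ≠xy
    from (inj₂ (inj₁ ac)) =
      inj₂ (inj₁ ac) , λ xy=uv → ac∉G (E-resp-SamePair G (SamePair-trans (SamePair-sym ac) xy=uv) xy)
    from (inj₂ (inj₂ bd)) =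
      inj₂ (inj₂ bd) , λ xy=uv → bd∉G (E-resp-SamePair G (SamePair-trans (SamePair-sym bd) xy=uv) xy)

switch-flip : ∀ {n} (G : Graph n) (a b c d : Fin n) (a≢c : ¬ a ≡ c) (b≢d : ¬ b ≡ d) →
              switch G a b c d a≢c b≢d ≐ switch G b a d c b≢d a≢c
switch-flip G a b c d a≢c b≢d = switch-flip-⊆ G a b c d a≢c b≢d , switch-flip-⊆ G b a d c b≢d a≢c

addEdge-deleteEdge : ∀ {n} (G : Graph n) {x y : Fin n} (x≢y : ¬ x ≡ y) → E G x y →
                     addEdge (deleteEdge G x y) x y x≢y ≐ G
addEdge-deleteEdge G {x} {y} x≢y xy =
  mk⊆ (λ { (inj₁ (e , _)) → e ; (inj₂ uv) → E-resp-SamePair G uv xy }) , mk⊆ restore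
  where
  restore : ∀ {u v} → E G u v → E (addEdge (deleteEdge G x y) x y x≢y) u v
  restore {u} {v} e with SamePair? u v _ _
  ... | yes uv = inj₂ uv
  ... | no ≠xy = inj₁ (e , ≠xy)

addEdge-nonEdge : ∀ {n} {S G : Graph n} {u v p q : Fin n} (u≢v : ¬ u ≡ v) →
                  S ⊆ G → ¬ E G p q → ¬ SamePair p q u v →
                  ¬ E (addEdge S u v u≢v) p q
addEdge-nonEdge u≢v S⊆G pq∉G pq≠uv (inj₁ e) = pq∉G (⊆-E S⊆G e)
addEdge-nonEdge u≢v S⊆G pq∉G pq≠uv (inj₂ pq=uv) = pq≠uv pq=uv

Cyc-⊆ : ∀ {n} (G : Graph n) → Cyc G ⊆ G
Cyc-⊆ G = mk⊆ proj₁

Cycle-in-Cyc : ∀ {n} {G : Graph n} → Cycle G → Cycle (Cyc G)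
Cycle-in-Cyc C =
  record { len = len C ; vtx = vtx C ; inj = inj C ; adj = λ i → adj C i , (C , i , refl) , (C , next i , refl) }

AtMostOneCycle : ∀ {n} → Graph n → Set
AtMostOneCycle G = ∀ (C D : Cycle G) → SameCycle C D

Unicyclic⇒AtMostOneCycle : ∀ {n} {G : Graph n} → Unicyclic G → AtMostOneCycle G
Unicyclic⇒AtMostOneCycle (_ , C₀ , unique) C D =
  SameCycle-trans {C = C} {D = C₀} {F = D} (SameCycle-sym {C = C₀} {D = C} (unique C)) (unique D)

AtMostOneCycle-anti : ∀ {n} {G H : Graph n} → G ⊆ H → AtMostOneCycle H → AtMostOneCycle G
AtMostOneCycle-anti G⊆H one C D = one (mapCycle G⊆H C) (mapCycle G⊆H D)

module _ {n : ℕ} {G H : Graph n} (iso : Isomorphic G H) where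
  private
    f = Inverse.to (proj₁ iso)
    f-injective : ∀ {x y} → f x ≡ f y → x ≡ y
    f-injective = Injection.injective (↔⇒↣ (proj₁ iso))

  imageCycle : Cycle G → Cycle H
  imageCycle C = record { len = len C ; vtx = λ i → f (vtx C i) ; inj = λ i j e → inj C i j (f-injective e)
                        ; adj = λ i → Equivalence.to (proj₂ iso _ _) (adj C i) }

  AtMostOneCycle-iso : AtMostOneCycle H → AtMostOneCycle G
  AtMostOneCycle-iso one C D x y = mk⇔ (transfer C D) (transfer D C)
    where
    transfer : (C D : Cycle G) → CycleEdge C x y → CycleEdge D x y
    transfer C D (i , xy) with Equivalence.to (one (imageCycle C) (imageCycle D) (f x) (f y)) (i , SamePair-map f xy)
    ... | j , fxy = j , SamePair-unmap f f-injective fxy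

module UnicyclicGraph {n : ℕ} (U : Graph n) (unicyclic : Unicyclic U) where
  connected : Connected U
  connected = proj₁ unicyclic

  C : Cycle U
  C = proj₁ (proj₂ unicyclic)

  unique : ∀ D → SameCycle C D
  unique = proj₂ (proj₂ unicyclic)

  open CycleIndex C public
  open UniqueCycle C unique public

  OnCycle⇒vertex : ∀ {x} → OnCycle U x → Σ ℕ λ p → x ≡ vertex p
  OnCycle⇒vertex (D , i , refl)
    with CycleEdge⇒EdgeAt (Equivalence.from (unique D (vtx D i) (vtx D (next i))) (i , SamePair-refl))
  ... | k , inj₁ (x≡k , _) = k , x≡k
  ... | k , inj₂ (x≡sk , _) = suc k , x≡sk

  vertex-OnCycle : ∀ j → OnCycle U (vertex j)
  vertex-OnCycle j = C , position j , vtx-position j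

  EdgeAt⇒CycE : ∀ {k x y} → EdgeAt k x y → CycE U x y
  EdgeAt⇒CycE {k} (inj₁ (refl , refl)) = vertex-adj k , vertex-OnCycle k , vertex-OnCycle (suc k)
  EdgeAt⇒CycE {k} (inj₂ (refl , refl)) = sym U (vertex-adj k) , vertex-OnCycle (suc k) , vertex-OnCycle k

  -- An edge from vertex p to vertex (s + p) with s ≥ 2 closes the arc vertex p … vertex (s + p) into a
  -- cycle, which by uniqueness is C: so it is an edge of C after all.
  CycE⇒EdgeAt : ∀ {x y} → CycE U x y → Σ ℕ λ k → EdgeAt k x y
  CycE⇒EdgeAt {x} {y} (xy , x-on , y-on) with OnCycle⇒vertex x-on | OnCycle⇒vertex y-on
  ... | p , refl | q , refl with offset q p
  ... | zero , _ , p≈q = ⊥-elim (irrefl U (subst (E U (vertex p)) (≡-sym (vertex-cong p≈q)) xy))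
  ... | suc zero , _ , sp≈q = p , inj₁ (refl , ≡-sym (vertex-cong sp≈q))
  ... | suc (suc l′) , l′+2<M , l′+2+p≈q
    with CycleEdge⇒EdgeAt (Equivalence.from (unique chordCycle _ _) (arc-closingEdge U p l′ along closing l′+2<M))
    where
    along : ∀ t → t < suc (suc l′) → E U (vertex (t + p)) (vertex (suc (t + p)))
    along t _ = vertex-adj (t + p)
    closing : E U (vertex (suc (suc l′) + p)) (vertex p)
    closing = subst (λ z → E U z (vertex p)) (≡-sym (vertex-cong l′+2+p≈q)) (sym U xy)
    chordCycle : Cycle U
    chordCycle = arc U p l′ along closing l′+2<M
  ...   | k , e = k , SamePair-trans (inj₂ (refl , ≡-sym (vertex-cong l′+2+p≈q))) e

module SplitBySwitch {n : ℕ} (G : Graph n) (a b c d : Fin n) (a≢c : ¬ a ≡ c) (b≢d : ¬ b ≡ d)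
                     (sw : TwoSwitch G a b c d) (G-ab-tree : IsTree (deleteEdge G a b)) where
  open TwoSwitch sw

  S : Graph n
  S = deleteEdge (deleteEdge G a b) c d

  trees : TwoTrees S c d
  trees = deleteEdge-TwoTrees G-ab-tree
            (cd∈G , λ { (inj₁ (c≡a , _)) → a≢c (≡-sym c≡a) ; (inj₂ (c≡b , _)) → b≢c (≡-sym c≡b) })

  private
    S⊆G : S ⊆ G
    S⊆G = ⊆-trans (deleteEdge-⊆ _ c d) (deleteEdge-⊆ G a b)

  switch-unicyclic-if-a↝d : Walk S a d → Unicyclic (switch G a b c d a≢c b≢d)
  switch-unicyclic-if-a↝d a↝d =
    Unicyclic-resp (≐-sym (switch-≐-addEdge² G a b c d a≢c b≢d))
      (tree+edge-unicyclic _ b d b≢d (TwoTrees-join a≢c (TwoTrees-swap trees) a↝d here)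
        (addEdge-nonEdge a≢c S⊆G bd∉G λ { (inj₁ (b≡a , _)) → a≢b (≡-sym b≡a) ; (inj₂ (b≡c , _)) → b≢c b≡c }))

  switch-unicyclic-if-b↝c : Walk S b c → Unicyclic (switch G a b c d a≢c b≢d)
  switch-unicyclic-if-b↝c b↝c =
    Unicyclic-resp (≐-trans (addEdge-comm S b≢d a≢c) (≐-sym (switch-≐-addEdge² G a b c d a≢c b≢d)))
      (tree+edge-unicyclic _ a c a≢c (TwoTrees-join b≢d trees b↝c here)
        (addEdge-nonEdge b≢d S⊆G ac∉G λ { (inj₁ (a≡b , _)) → a≢b a≡b ; (inj₂ (a≡d , _)) → a≢d a≡d }))

module SwitchOnUnicyclic {n : ℕ} (U : Graph n) (a b c d : Fin n) (unicyclic : Unicyclic U)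
                         (sw : TwoSwitch U a b c d) (a≢c : ¬ a ≡ c) (b≢d : ¬ b ≡ d) where
  open UnicyclicGraph U unicyclic
  open TwoSwitch sw

  τ : Graph n
  τ = switch U a b c d a≢c b≢d

  unicyclic-if-cycleEdge-forestEdge : CycE U a b → ForE U c d → Unicyclic τ
  unicyclic-if-cycleEdge-forestEdge ab-on (_ , cd-off) = from-reach (TwoTrees.reach trees a)
    where
    k : ℕ
    k = proj₁ (CycE⇒EdgeAt ab-on)
    ab-at-k : EdgeAt k a b
    ab-at-k = proj₂ (CycE⇒EdgeAt ab-on)
    open SplitBySwitch U a b c d a≢c b≢d sw (deleteCycleEdge-isTree connected k ab-at-k)
    -- The rest of the cycle joins a and b inside S, since cd is off the cycle.
    a↝b : Walk S a b
    a↝b = Walk-resp-SamePair (SamePair-swapʳ ab-at-k) (walkAround S k λ j j≠k →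
            (vertex-adj j , λ q → j≠k (SamePair-trans q ab-at-k)) , λ q → cd-off (EdgeAt⇒CycE (SamePair-sym q)))
    from-reach : Walk S a c ⊎ Walk S a d → Unicyclic τ
    from-reach (inj₁ a↝c) = switch-unicyclic-if-b↝c (reverseʷ a↝b ++ʷ a↝c)
    from-reach (inj₂ a↝d) = switch-unicyclic-if-a↝d a↝d

  deleteEdge-switch : ∀ {x y} → E U x y → deleteEdge τ x y ≐ switch (deleteEdge U x y) a b c d a≢c b≢d
  deleteEdge-switch xy = switch-deleteEdge-comm U a b c d a≢c b≢d xy ac∉G bd∉G

  module _ (ab-off : ¬ CycE U a b) (cd-off : ¬ CycE U c d) where

    Cyc⊆τ : Cyc U ⊆ τ
    Cyc⊆τ = mk⊆ λ xy-on → inj₁ (proj₁ xy-on , (λ q → ab-off (E-resp-SamePair (Cyc U) (SamePair-sym q) xy-on))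
                                             , (λ q → cd-off (E-resp-SamePair (Cyc U) (SamePair-sym q) xy-on)))

    -- τ keeps C as a cycle, so deleting an edge of C from the unicyclic τ leaves a tree.
    t-switches-if-unicyclic : Unicyclic τ → ∀ x y → CycE U x y → IsTSwitch (deleteEdge U x y) a b c d a≢c b≢d
    t-switches-if-unicyclic τ-unicyclic x y xy-on =
      deleteCycleEdge-isTree connected k xy-at-k ,
      IsTwoSwitch-deleteEdge a≢c b≢d sw ab≠xy cd≠xy ,
      IsTree-resp (deleteEdge-switch (proj₁ xy-on))
                  (UniqueCycle.deleteCycleEdge-isTree Cτ (Unicyclic⇒AtMostOneCycle τ-unicyclic Cτ)
                                                      (proj₁ τ-unicyclic) k xy-at-k)
      where
      k : ℕ
      k = proj₁ (CycE⇒EdgeAt xy-on)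
      xy-at-k : EdgeAt k x y
      xy-at-k = proj₂ (CycE⇒EdgeAt xy-on)
      Cτ : Cycle τ
      Cτ = mapCycle Cyc⊆τ (Cycle-in-Cyc C)
      ab≠xy : ¬ SamePair a b x y
      ab≠xy q = ab-off (E-resp-SamePair (Cyc U) q xy-on)
      cd≠xy : ¬ SamePair c d x y
      cd≠xy q = cd-off (E-resp-SamePair (Cyc U) q xy-on)

    unicyclic-if-t-switches : (∀ x y → CycE U x y → IsTSwitch (deleteEdge U x y) a b c d a≢c b≢d) → Unicyclic τ
    unicyclic-if-t-switches t-switches =
      Unicyclic-resp (addEdge-deleteEdge τ x≢y (⊆-E Cyc⊆τ xy-on))
        (tree+edge-unicyclic (deleteEdge τ x y) x y x≢y
          (IsTree-resp (≐-sym (deleteEdge-switch (vertex-adj 0))) (proj₂ (proj₂ (t-switches x y xy-on))))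
          (λ e → proj₂ e SamePair-refl))
      where
      x y : Fin n
      x = vertex 0
      y = vertex 1
      xy-on : CycE U x y
      xy-on = EdgeAt⇒CycE SamePair-refl
      x≢y : ¬ x ≡ y
      x≢y x≡y = irrefl U (subst (λ z → E U z y) x≡y (vertex-adj 0))

module SegmentReversal {n : ℕ} (M : ℕ) (P : ℕ → Fin n)
                       (P-injective : ∀ {o o′} → o < M → o′ < M → P o ≡ P o′ → o ≡ o′) (s : ℕ) (s<M : s < M) where

  private
    Hit : Fin n → Set
    Hit x = Σ (Fin M) λ o → P (toℕ o) ≡ x

    hit? : ∀ x → Dec (Hit x)
    hit? x = any? λ o → P (toℕ o) ≟ᶠ x

    reverseAt : Fin n → (o : ℕ) → Dec (o ≤ s) → Fin n
    reverseAt x o (yes _) = P (s ∸ o)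
    reverseAt x o (no _) = x

    reverseHit : (x : Fin n) → Dec (Hit x) → Fin n
    reverseHit x (yes (o , _)) = reverseAt x (toℕ o) (toℕ o ≤? s)
    reverseHit x (no _) = x

  reverse : Fin n → Fin n
  reverse x = reverseHit x (hit? x)

  private
    reverse-P : ∀ o → o < M → reverse (P o) ≡ reverseAt (P o) o (o ≤? s)
    reverse-P o o<M = go (hit? (P o))
      where
      go : (h : Dec (Hit (P o))) → reverseHit (P o) h ≡ reverseAt (P o) o (o ≤? s)
      go (yes (o′ , e)) = cong (λ k → reverseAt (P o) k (k ≤? s)) (P-injective (toℕ<n o′) o<M e)
      go (no miss) = ⊥-elim (miss (fromℕ< o<M , cong P (toℕ-fromℕ< o<M)))

    reverse-outside : ∀ x → ¬ Hit x → reverse x ≡ x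
    reverse-outside x miss = go (hit? x)
      where
      go : (h : Dec (Hit x)) → reverseHit x h ≡ x
      go (yes hit) = ⊥-elim (miss hit)
      go (no _) = refl

  reverse-≤ : ∀ o → o ≤ s → reverse (P o) ≡ P (s ∸ o)
  reverse-≤ o o≤s with o ≤? s | reverse-P o (≤-<-trans o≤s s<M)
  ... | yes _ | e = e
  ... | no o≰s | _ = ⊥-elim (o≰s o≤s)

  reverse-> : ∀ o → s < o → o < M → reverse (P o) ≡ P o
  reverse-> o s<o o<M with o ≤? s | reverse-P o o<M
  ... | yes o≤s | _ = ⊥-elim (<-irrefl refl (<-≤-trans s<o o≤s))
  ... | no _ | e = e

  reverse-involutive : ∀ x → reverse (reverse x) ≡ x
  reverse-involutive x with hit? x
  ... | no miss = reverse-outside x miss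
  ... | yes (o , refl) with toℕ o ≤? s
  ...   | yes o≤s = trans (reverse-≤ (s ∸ toℕ o) (m∸n≤m s (toℕ o))) (cong P (m∸[m∸n]≡n o≤s))
  ...   | no o≰s = reverse-> (toℕ o) (≰⇒> o≰s) (toℕ<n o)

  reversal : Fin n ↔ Fin n
  reversal = mk↔ₛ′ reverse reverse reverse-involutive reverse-involutive

module CyclicSwitch {n : ℕ} (U : Graph n) (unicyclic : Unicyclic U) (a b c d : Fin n) (a≢c : ¬ a ≡ c) (b≢d : ¬ b ≡ d)
                    (sw : TwoSwitch U a b c d) where
  open UnicyclicGraph U unicyclic
  open TwoSwitch sw

  τ τc : Graph n
  τ = switch U a b c d a≢c b≢d
  τc = switch (Cyc U) a b c d a≢c b≢d

  last : ℕ
  last = suc (suc (len C))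

  last<M : last < M
  last<M = ≤-refl

  -- C read from b: P 0 = b, P 1, …, P last = a, and P M = P 0 again.
  module Anchored (p : ℕ) (a-at : a ≡ vertex (last + p)) (b-at : b ≡ vertex p) where

    P : ℕ → Fin n
    P o = vertex (o + p)

    P-injective : ∀ {o o′} → o < M → o′ < M → P o ≡ P o′ → o ≡ o′
    P-injective o<M o′<M e = +-cancelʳ-< p o<M o′<M (vertex-injective e)

    P-M : P M ≡ P 0
    P-M = vertex-cong (M+-≈ p)

    EdgeP : ℕ → Fin n → Fin n → Set
    EdgeP o = EdgeAt (o + p)

    CycE⇒EdgeP : ∀ {x y} → CycE U x y → Σ ℕ λ o → o < M × EdgeP o x y
    CycE⇒EdgeP {x} {y} xy-on = reindex (CycE⇒EdgeAt xy-on)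
      where
      reindex : (Σ ℕ λ k → EdgeAt k x y) → Σ ℕ λ o → o < M × EdgeP o x y
      reindex (k , xy) with offset k p
      ... | o , o<M , o+p≈k =
        o , o<M , subst₂ (SamePair x y) (≡-sym (vertex-cong o+p≈k)) (≡-sym (vertex-cong (+-congˡ 1 o+p≈k))) xy

    EdgeP-distinct : ∀ {o o′ x y} → o < M → o′ < M → ¬ o ≡ o′ → EdgeP o′ x y →
                     ¬ SamePair (P o) (P (suc o)) x y
    EdgeP-distinct o<M o′<M o≢o′ xy q = o≢o′ (+-cancelʳ-< p o<M o′<M (EdgeAt-injective (SamePair-trans q xy)))

    ab-at-last : EdgeP last a b
    ab-at-last = inj₁ (a-at , trans b-at (≡-sym P-M))

    module _ {s : ℕ} (s<M : s < M) (cd-at-s : EdgeP s c d)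
             {o : ℕ} (o<M : o < M) (o≢last : ¬ o ≡ last) (o≢s : ¬ o ≡ s) where
      private
        off-ab : ¬ SamePair (P o) (P (suc o)) a b
        off-ab = EdgeP-distinct o<M last<M o≢last ab-at-last
        off-cd : ¬ SamePair (P o) (P (suc o)) c d
        off-cd = EdgeP-distinct o<M s<M o≢s cd-at-s

      P-edge-kept : E (deleteEdge (deleteEdge U a b) c d) (P o) (P (suc o))
      P-edge-kept = (vertex-adj (o + p) , off-ab) , off-cd

      P-edge-τ : E τ (P o) (P (suc o))
      P-edge-τ = inj₁ (vertex-adj (o + p) , off-ab , off-cd)

      P-edge-τc : E τc (P o) (P (suc o))
      P-edge-τc = inj₁ (EdgeAt⇒CycE {o + p} SamePair-refl , off-ab , off-cd)

    module Aligned (s : ℕ) (s<M : s < M) (c-at : c ≡ P s) (d-at : d ≡ P (suc s)) where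

      cd-at-s : EdgeP s c d
      cd-at-s = inj₁ (c-at , d-at)

      s<last : s < last
      s<last = ≤∧≢⇒< (≤-pred s<M) λ s≡last → a≢c (trans a-at (trans (cong P (≡-sym s≡last)) (≡-sym c-at)))

      τ-unicyclic : Unicyclic τ
      τ-unicyclic = switch-unicyclic-if-b↝c (subst₂ (Walk S) (≡-sym b-at) (≡-sym c-at) (forwardWalk S p s along))
        where
        open SplitBySwitch U a b c d a≢c b≢d sw (deleteCycleEdge-isTree connected (last + p) ab-at-last)
        along : ∀ t → t < s → E S (P t) (P (suc t))
        along t t<s = P-edge-kept s<M cd-at-s t<M t≢last t≢s
          where
          t<M : t < M
          t<M = <-trans t<s s<M
          t≢last : ¬ t ≡ last
          t≢last t≡last = <-irrefl t≡last (<-trans t<s s<last)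
          t≢s : ¬ t ≡ s
          t≢s t≡s = <-irrefl t≡s t<s

      open SegmentReversal M P P-injective s s<M

      reverse-at-s : reverse (P s) ≡ b
      reverse-at-s = trans (reverse-≤ s ≤-refl) (trans (cong P (n∸n≡0 s)) (≡-sym b-at))

      reverse-at-suc-s : reverse (P (suc s)) ≡ d
      reverse-at-suc-s = trans (reverse-> (suc s) (n<1+n s) (s≤s s<last)) (≡-sym d-at)

      reverse-at-last : reverse (P last) ≡ a
      reverse-at-last = trans (reverse-> last s<last last<M) (≡-sym a-at)

      reverse-at-M : reverse (P M) ≡ c
      reverse-at-M = trans (cong reverse P-M) (trans (reverse-≤ 0 z≤n) (≡-sym c-at))

      reverse-swap : ∀ {u v} → reverse u ≡ v → reverse v ≡ u
      reverse-swap {u} refl = reverse-involutive u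

      reverse-low : ∀ {o x y} → o < s → SamePair x y (reverse (P o)) (reverse (P (suc o))) → EdgeP (s ∸ suc o) x y
      reverse-low {o} o<s xy =
        SamePair-swapʳ (subst₂ (SamePair _ _) (trans (reverse-≤ o (<⇒≤ o<s)) (cong P (+-∸-assoc 1 o<s)))
                                              (reverse-≤ (suc o) o<s) xy)

      reverse-low< : ∀ {o} → o < s → s ∸ suc o < s
      reverse-low< {o} o<s = subst (_≤ s) (+-∸-assoc 1 o<s) (m∸n≤m s o)

      reverse-high : ∀ {o x y} → s < o → o < last → SamePair x y (reverse (P o)) (reverse (P (suc o))) → EdgeP o x y
      reverse-high {o} s<o o<last xy =
        subst₂ (SamePair _ _) (reverse-> o s<o (<-trans o<last last<M))
                              (reverse-> (suc o) (<-trans s<o (n<1+n o)) (s≤s o<last)) xy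

      reverse-preserves : ∀ x y → E τc x y → CycE U (reverse x) (reverse y)
      reverse-preserves x y (inj₁ (xy-on , ≠ab , ≠cd)) = kept (CycE⇒EdgeP xy-on)
        where
        kept : (Σ ℕ λ o → o < M × EdgeP o x y) → CycE U (reverse x) (reverse y)
        kept (o , o<M , xy) = by-order (<-cmp o s) (m≤n⇒m<n∨m≡n (≤-pred o<M))
          where
          by-order : Tri (o < s) (o ≡ s) (s < o) → o < last ⊎ o ≡ last → CycE U (reverse x) (reverse y)
          by-order (tri< o<s _ _) _ = EdgeAt⇒CycE (reverse-low o<s (SamePair-map reverse xy))
          by-order (tri≈ _ refl _) _ = ⊥-elim (≠cd (SamePair-trans xy (SamePair-sym cd-at-s)))
          by-order (tri> _ _ s<o) (inj₁ o<last) = EdgeAt⇒CycE (reverse-high s<o o<last (SamePair-map reverse xy))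
          by-order (tri> _ _ _) (inj₂ refl) = ⊥-elim (≠ab (SamePair-trans xy (SamePair-sym ab-at-last)))
      reverse-preserves x y (inj₂ (inj₁ ac)) =
        EdgeAt⇒CycE {last + p}
          (subst₂ (SamePair _ _) (reverse-swap reverse-at-last) (reverse-swap reverse-at-M) (SamePair-map reverse ac))
      reverse-preserves x y (inj₂ (inj₂ bd)) =
        EdgeAt⇒CycE {s + p}
          (subst₂ (SamePair _ _) (reverse-swap reverse-at-s) (reverse-swap reverse-at-suc-s) (SamePair-map reverse bd))

      reverse-reflects : ∀ x y → CycE U (reverse x) (reverse y) → E τc x y
      reverse-reflects x y rxy-on = found (CycE⇒EdgeP rxy-on)
        where
        back : ∀ {o} → EdgeP o (reverse x) (reverse y) → SamePair x y (reverse (P o)) (reverse (P (suc o)))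
        back e = subst₂ (λ u v → SamePair u v _ _) (reverse-involutive x) (reverse-involutive y) (SamePair-map reverse e)
        kept : ∀ {o} → o < last → ¬ o ≡ s → EdgeP o x y → E τc x y
        kept {o} o<last o≢s xy = E-resp-SamePair τc xy (P-edge-τc s<M cd-at-s o<M o≢last o≢s)
          where
          o<M : o < M
          o<M = <-trans o<last last<M
          o≢last : ¬ o ≡ last
          o≢last o≡last = <-irrefl o≡last o<last
        found : (Σ ℕ λ o → o < M × EdgeP o (reverse x) (reverse y)) → E τc x y
        found (o , o<M , e) = by-order (<-cmp o s) (m≤n⇒m<n∨m≡n (≤-pred o<M))
          where
          by-order : Tri (o < s) (o ≡ s) (s < o) → o < last ⊎ o ≡ last → E τc x y
          by-order (tri< o<s _ _) _ =
            kept (<-trans (reverse-low< o<s) s<last) (λ o′≡s → <-irrefl o′≡s (reverse-low< o<s))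
                 (reverse-low o<s (back e))
          by-order (tri≈ _ refl _) _ = inj₂ (inj₂ (subst₂ (SamePair x y) reverse-at-s reverse-at-suc-s (back e)))
          by-order (tri> _ _ s<o) (inj₁ o<last) =
            kept o<last (λ o≡s → <-irrefl (≡-sym o≡s) s<o) (reverse-high s<o o<last (back e))
          by-order (tri> _ _ _) (inj₂ refl) = inj₂ (inj₁ (subst₂ (SamePair x y) reverse-at-last reverse-at-M (back e)))

      reversal-iso : Isomorphic τc (Cyc U)
      reversal-iso = reversal , λ x y → mk⇔ (reverse-preserves x y) (reverse-reflects x y)

    module Crossed (s″ : ℕ) (s<M : suc (suc s″) < M)
                   (d-at : d ≡ P (suc (suc s″))) (c-at : c ≡ P (suc (suc (suc s″)))) where

      s : ℕ
      s = suc (suc s″)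

      cd-at-s : EdgeP s c d
      cd-at-s = inj₂ (c-at , d-at)

      s<last : s < last
      s<last = ≤∧≢⇒< (≤-pred s<M) λ s≡last → a≢d (trans a-at (trans (cong P (≡-sym s≡last)) (≡-sym d-at)))

      s+1<last : suc s < last
      s+1<last = ≤∧≢⇒< s<last λ s+1≡last → a≢c (trans a-at (trans (cong P (≡-sym s+1≡last)) (≡-sym c-at)))

      s+2<last : suc (suc s) < last
      s+2<last = ≤∧≢⇒< s+1<last λ s+2≡last →
        ac∉G (sym U (subst₂ (E U) (≡-sym c-at) (trans (cong P s+2≡last) (≡-sym a-at)) (vertex-adj (suc s + p))))

      r : ℕ
      r = proj₁ (m≤n⇒∃[o]m+o≡n s+2<last)

      r+2+s+1≡last : suc (suc r) + suc s ≡ last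
      r+2+s+1≡last = trans (cong (λ z → suc (suc z)) (+-comm r (suc s))) (proj₂ (m≤n⇒∃[o]m+o≡n s+2<last))

      a-at′ : a ≡ vertex (suc (suc r) + (suc s + p))
      a-at′ = trans a-at (cong vertex (trans (cong (_+ p) (≡-sym r+2+s+1≡last)) (+-assoc (suc (suc r)) (suc s) p)))

      -- Removing ab and cd cuts C into the arcs b … d and c … a; the new edges db and ac close each
      -- of them into a cycle, and only the first contains db.
      two-cycles : (H : Graph n) → (∀ {o} → o < M → ¬ o ≡ last → ¬ o ≡ s → E H (P o) (P (suc o))) →
                   E H d b → E H a c → ¬ AtMostOneCycle H
      two-cycles H along db ac one = second-avoids-db (Equivalence.to (one first second d b) first-db)
        where
        along₁ : ∀ t → t < s → E H (P t) (P (suc t))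
        along₁ t t<s =
          along (<-trans t<s s<M) (λ t≡last → <-irrefl t≡last (<-trans t<s s<last)) (λ t≡s → <-irrefl t≡s t<s)

        closing₁ : E H (P s) (P 0)
        closing₁ = subst₂ (E H) d-at b-at db

        first : Cycle H
        first = arc H p s″ along₁ closing₁ s<M

        first-db : CycleEdge first d b
        first-db = subst₂ (CycleEdge first) (≡-sym d-at) (≡-sym b-at) (arc-closingEdge H p s″ along₁ closing₁ s<M)

        q : ℕ
        q = suc s + p

        along₂ : ∀ t → t < suc (suc r) → E H (vertex (t + q)) (vertex (suc (t + q)))
        along₂ t t<r+2 = subst (λ z → E H (vertex z) (vertex (suc z))) (+-assoc t (suc s) p)
                               (along (<-trans t+s+1<last last<M) (λ eq → <-irrefl eq t+s+1<last)
                                      (λ eq → <-irrefl (≡-sym eq) (m≤n+m (suc s) t)))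
          where
          t+s+1<last : t + suc s < last
          t+s+1<last = subst (t + suc s <_) r+2+s+1≡last (+-monoˡ-< (suc s) t<r+2)

        closing₂ : E H (vertex (suc (suc r) + q)) (vertex q)
        closing₂ = subst₂ (E H) a-at′ c-at ac

        r+2<M : suc (suc r) < M
        r+2<M = s≤s (subst (suc (suc r) ≤_) r+2+s+1≡last (m≤m+n (suc (suc r)) (suc s)))

        second : Cycle H
        second = arc H q r along₂ closing₂ r+2<M

        second-avoids-db : ¬ CycleEdge second d b
        second-avoids-db e with arc-edges H q r along₂ closing₂ r+2<M e
        ... | inj₁ (t , _ , db-at) = bd∉G (sym U (E-resp-SamePair U db-at (vertex-adj (t + q))))
        ... | inj₂ (inj₁ (d-at′ , _)) = a≢d (trans a-at′ (≡-sym d-at′))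
        ... | inj₂ (inj₂ (_ , b-at′)) = a≢b (trans a-at′ (≡-sym b-at′))

      τ-not-unicyclic : ¬ Unicyclic τ
      τ-not-unicyclic τ-unicyclic =
        two-cycles τ (P-edge-τ s<M cd-at-s) (inj₂ (inj₂ (inj₂ (refl , refl)))) (inj₂ (inj₁ SamePair-refl))
                   (Unicyclic⇒AtMostOneCycle τ-unicyclic)

      τc-not-iso : ¬ Isomorphic τc (Cyc U)
      τc-not-iso iso =
        two-cycles τc (P-edge-τc s<M cd-at-s) (inj₂ (inj₂ (inj₂ (refl , refl)))) (inj₂ (inj₁ SamePair-refl))
                   (AtMostOneCycle-iso iso (AtMostOneCycle-anti (Cyc-⊆ U) (Unicyclic⇒AtMostOneCycle unicyclic)))

    unicyclic⇔iso : CycE U c d → (Unicyclic τ ⇔ Isomorphic τc (Cyc U))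
    unicyclic⇔iso cd-on = by-position (CycE⇒EdgeP cd-on)
      where
      by-position : (Σ ℕ λ s → s < M × EdgeP s c d) → (Unicyclic τ ⇔ Isomorphic τc (Cyc U))
      by-position (s , s<M , inj₁ (c-at , d-at)) = mk⇔ (λ _ → reversal-iso) (λ _ → τ-unicyclic)
        where open Aligned s s<M c-at d-at
      by-position (zero , _ , inj₂ (_ , d-at)) = ⊥-elim (b≢d (trans b-at (≡-sym d-at)))
      by-position (suc zero , _ , inj₂ (_ , d-at)) =
        ⊥-elim (bd∉G (subst₂ (E U) (≡-sym b-at) (≡-sym d-at) (vertex-adj p)))
      by-position (suc (suc s″) , s<M , inj₂ (c-at , d-at)) = mk⇔ (⊥-elim ∘ τ-not-unicyclic) (⊥-elim ∘ τc-not-iso)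
        where open Crossed s″ s<M d-at c-at

cycleEdges-unicyclic⇔iso : ∀ {n} (U : Graph n) (unicyclic : Unicyclic U) (a b c d : Fin n)
                           (a≢c : ¬ a ≡ c) (b≢d : ¬ b ≡ d) →
                           TwoSwitch U a b c d → CycE U a b → CycE U c d →
                           Unicyclic (switch U a b c d a≢c b≢d) ⇔ Isomorphic (switch (Cyc U) a b c d a≢c b≢d) (Cyc U)
cycleEdges-unicyclic⇔iso U unicyclic a b c d a≢c b≢d sw ab-on cd-on = by-orientation (CycE⇒EdgeAt ab-on)
  where
  open UnicyclicGraph U unicyclic
  shift : ∀ {x} i → x ≡ vertex i → x ≡ vertex (suc (suc (len C)) + suc i)
  shift i x-at = trans x-at (vertex-cong (≈-sym (≈-trans (≡⇒≈ (+-suc (suc (suc (len C))) i)) (M+-≈ i))))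
  by-orientation : (Σ ℕ λ i → EdgeAt i a b) →
                   Unicyclic (switch U a b c d a≢c b≢d) ⇔ Isomorphic (switch (Cyc U) a b c d a≢c b≢d) (Cyc U)
  by-orientation (i , inj₁ (a-at , b-at)) =
    CyclicSwitch.Anchored.unicyclic⇔iso U unicyclic a b c d a≢c b≢d sw (suc i) (shift i a-at) b-at cd-on
  by-orientation (i , inj₂ (a-at , b-at)) =
    mk⇔ (λ τ-unicyclic → Isomorphic-respˡ {K = Cyc U} (≐-sym flipᶜ) (Equivalence.to flipped (Unicyclic-resp flip τ-unicyclic)))
        (λ iso → Unicyclic-resp (≐-sym flip) (Equivalence.from flipped (Isomorphic-respˡ {K = Cyc U} flipᶜ iso)))
    where
    flip : switch U a b c d a≢c b≢d ≐ switch U b a d c b≢d a≢c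
    flip = switch-flip U a b c d a≢c b≢d
    flipᶜ : switch (Cyc U) a b c d a≢c b≢d ≐ switch (Cyc U) b a d c b≢d a≢c
    flipᶜ = switch-flip (Cyc U) a b c d a≢c b≢d
    flipped : Unicyclic (switch U b a d c b≢d a≢c) ⇔ Isomorphic (switch (Cyc U) b a d c b≢d a≢c) (Cyc U)
    flipped = CyclicSwitch.Anchored.unicyclic⇔iso U unicyclic b a d c b≢d a≢c (TwoSwitch-flip a≢c b≢d sw)
                                                   (suc i) (shift i b-at) a-at (sym (Cyc U) cd-on)

mainTheorem4 : ∀ {n : ℕ} (U : Graph n) (a b c d : Fin n)
    → Unicyclic U
    → (sw : IsTwoSwitch U a b c d)
    → (a≢c : ¬ a ≡ c) → (b≢d : ¬ b ≡ d)
    → ((ForE U a b → ForE U c d →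
          (Unicyclic (switch U a b c d a≢c b≢d)
            ⇔ (∀ (x y : Fin n) → CycE U x y →
                 IsTSwitch (deleteEdge U x y) a b c d a≢c b≢d)))
      × (CycE U a b → ForE U c d → Unicyclic (switch U a b c d a≢c b≢d))
      × (CycE U a b → CycE U c d →
          (Unicyclic (switch U a b c d a≢c b≢d)
            ⇔ Isomorphic (switch (Cyc U) a b c d a≢c b≢d) (Cyc U))))
mainTheorem4 U a b c d unicyclic sw a≢c b≢d =
  (λ (_ , ab-off) (_ , cd-off) → mk⇔ (t-switches-if-unicyclic ab-off cd-off) (unicyclic-if-t-switches ab-off cd-off)) ,
  unicyclic-if-cycleEdge-forestEdge ,
  cycleEdges-unicyclic⇔iso U unicyclic a b c d a≢c b≢d (twoSwitch sw)
  where open SwitchOnUnicyclic U a b c d unicyclic (twoSwitch sw) a≢c b≢d
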